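{- Let $k\geq 3$. There is no integer $v$ such that a $vgr(v,k,3,\binom{k}{2}-1)$-graph exists.
   Context: A $vgr(v,k,g,\lambda)$-graph is a $k$-regular graph of girth $g$ on $v$ vertices in which every vertex is contained in exactly $\lambda$ cycles of length $g$. -}

module Defs where

open import Data.Nat using (ℕ; zero; suc; _+_; _<ᵇ_)
open import Data.Bool using (Bool; true; false; _∧_; if_then_else_)
open import Data.Fin using (Fin; toℕ)
open import Data.Product using (Σ; _×_; ∃-syntax)
open import Relation.Binary.PropositionalEquality using (_≡_)

count : ∀ {n} → (Fin n → Bool) → ℕ
count {zero}  p = 0
count {suc n} p = (if p Fin.zero then 1 else 0) + count (λ i → p (Fin.suc i))

record Graph (v : ℕ) : Set where
  field
    adj    : Fin v → Fin v → Bool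
    sym    : ∀ x y → adj x y ≡ adj y x
    irrefl : ∀ x → adj x x ≡ false
open Graph public

degree : ∀ {v} → Graph v → Fin v → ℕ
degree G x = count (adj G x)

Regular : ∀ {v} → Graph v → ℕ → Set
Regular G k = ∀ x → degree G x ≡ k

IsTriangle : ∀ {v} → Graph v → Fin v → Fin v → Fin v → Set
IsTriangle G x y z = (adj G x y ∧ adj G y z ∧ adj G x z) ≡ true

-- In a simple graph there are no cycles of length < 3, so the girth is 3
-- exactly when the graph contains a cycle of length 3.
Girth3 : ∀ {v} → Graph v → Set
Girth3 G = ∃[ x ] ∃[ y ] ∃[ z ] IsTriangle G x y z

sumFin : ∀ {n} → (Fin n → ℕ) → ℕ
sumFin {zero}  f = 0
sumFin {suc n} f = f Fin.zero + sumFin (λ i → f (Fin.suc i))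

trianglesAt : ∀ {v} → Graph v → Fin v → ℕ
trianglesAt G x =
  sumFin (λ y → count (λ z → (toℕ y <ᵇ toℕ z) ∧ adj G x y ∧ adj G x z ∧ adj G y z))

{-# OPTIONS --safe #-}
-- Counting pairs of neighbours of x, the triangles through x and the non-adjacent pairs
-- in N(x) add up to (k choose 2), so every neighbourhood misses exactly one edge.
-- Let yz be the edge missing at x. Any third neighbour w of x is then adjacent to y
-- and z, and as y ≁ z, at most k − 1 neighbours of y lie in {x} ∪ N(x), so y has a
-- neighbour u outside it. If w ∼ u, then yz and xu are two non-edges in N(w);
-- otherwise xu and wu are two non-edges in N(y).
module Submission where

open import Defs hiding (sym)
open import Data.Nat using (ℕ; _≤_; _∸_)
open import Data.Nat.Combinatorics using (_C_)
open import Data.Empty using (⊥)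
open import Relation.Binary.PropositionalEquality using (_≡_)

import Algebra.Properties.CommutativeSemigroup as CommSemigroupProperties
open import Data.Bool using (Bool; true; false; _∧_; not; if_then_else_)
open import Data.Bool.Properties using (T-≡; ∧-zeroʳ; ¬-not) renaming (_≟_ to _≟ᵇ_)
open import Data.Empty using (⊥-elim)
open import Data.Fin using (Fin; zero; suc; toℕ)
open import Data.Fin.Properties using (_≟_; toℕ-injective)
open import Data.Nat using (zero; suc; _+_; _<_; _<ᵇ_; z≤n; s≤s; s≤s⁻¹; z<s)
open import Data.Nat.Combinatorics using (nC1≡n; nCk+nC[k+1]≡[n+1]C[k+1])
open import Data.Nat.Properties
  using ( ≤-trans; ≤-reflexive; +-mono-≤; +-monoʳ-≤; m≤m+n; m≤n+m; n≤1+n; +-comm; +-suc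
        ; +-cancelˡ-≡; +-cancelʳ-<; m∸n+n≡m; suc-injective; <-irrefl; ≤⇒≯; <-cmp
        ; <⇒<ᵇ; <ᵇ⇒<; +-commutativeSemigroup; module ≤-Reasoning)
open import Data.Product using (∃-syntax; ∃₂; _×_; _,_; proj₁; proj₂; map₂)
open import Data.Sum using (_⊎_; inj₁; inj₂)
open import Function using (_∘_; Equivalence)
open import Relation.Binary.Definitions using (tri<; tri≈; tri>)
open import Relation.Binary.PropositionalEquality using (_≢_; refl; sym; trans; cong; cong₂; subst; module ≡-Reasoning)
open import Relation.Nullary using (¬_)
open import Relation.Nullary.Decidable using (yes; no; does; dec-false)

open CommSemigroupProperties +-commutativeSemigroup using (interchange)

∧-true⁻ : ∀ {a b} → a ∧ b ≡ true → a ≡ true × b ≡ true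
∧-true⁻ {true} b≡true = refl , b≡true

not-true⁻ : ∀ {a} → not a ≡ true → a ≡ false
not-true⁻ {false} refl = refl

∧-leftComm : ∀ a b c → a ∧ (b ∧ c) ≡ b ∧ (a ∧ c)
∧-leftComm true  b c = refl
∧-leftComm false b c = sym (∧-zeroʳ b)

sumFin-cong : ∀ {n} {f g : Fin n → ℕ} → (∀ i → f i ≡ g i) → sumFin f ≡ sumFin g
sumFin-cong {zero}  f≗g = refl
sumFin-cong {suc n} f≗g = cong₂ _+_ (f≗g zero) (sumFin-cong (f≗g ∘ suc))

sumFin-mono : ∀ {n} {f g : Fin n → ℕ} → (∀ i → f i ≤ g i) → sumFin f ≤ sumFin g
sumFin-mono {zero}  f≤g = z≤n
sumFin-mono {suc n} f≤g = +-mono-≤ (f≤g zero) (sumFin-mono (f≤g ∘ suc))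

sumFin-distrib-+ : ∀ {n} (f g : Fin n → ℕ) → sumFin (λ i → f i + g i) ≡ sumFin f + sumFin g
sumFin-distrib-+ {zero}  f g = refl
sumFin-distrib-+ {suc n} f g =
  trans (cong (f zero + g zero +_) (sumFin-distrib-+ (f ∘ suc) (g ∘ suc)))
        (interchange (f zero) (g zero) (sumFin (f ∘ suc)) (sumFin (g ∘ suc)))

sumFin-point : ∀ {n} (f : Fin n → ℕ) i → f i ≤ sumFin f
sumFin-point f zero    = m≤m+n (f zero) _
sumFin-point f (suc i) = ≤-trans (sumFin-point (f ∘ suc) i) (m≤n+m _ (f zero))

sumFin-two-points : ∀ {n} (f : Fin n → ℕ) {i j} → i ≢ j → f i + f j ≤ sumFin f
sumFin-two-points f {zero}  {zero}  0≢0 = ⊥-elim (0≢0 refl)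
sumFin-two-points f {zero}  {suc j} _   = +-monoʳ-≤ (f zero) (sumFin-point (f ∘ suc) j)
sumFin-two-points f {suc i} {zero}  _   =
  subst (_≤ sumFin f) (+-comm (f zero) (f (suc i))) (+-monoʳ-≤ (f zero) (sumFin-point (f ∘ suc) i))
sumFin-two-points f {suc i} {suc j} i≢j =
  ≤-trans (sumFin-two-points (f ∘ suc) (i≢j ∘ cong suc)) (m≤n+m _ (f zero))

sumFin²-two-points : ∀ {m n} (f : Fin m → Fin n → ℕ) {i₁ j₁ i₂ j₂} → (i₁ , j₁) ≢ (i₂ , j₂) →
  f i₁ j₁ + f i₂ j₂ ≤ sumFin (λ i → sumFin (f i))
sumFin²-two-points f {i₁} {j₁} {i₂} {j₂} p₁≢p₂ with i₁ ≟ i₂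
... | no i₁≢i₂ = ≤-trans (+-mono-≤ (sumFin-point (f i₁) j₁) (sumFin-point (f i₂) j₂))
                         (sumFin-two-points (λ i → sumFin (f i)) i₁≢i₂)
... | yes refl = ≤-trans (sumFin-two-points (f i₁) (p₁≢p₂ ∘ cong (i₁ ,_)))
                         (sumFin-point (λ i → sumFin (f i)) i₁)

sumFin-witness : ∀ {n} (f : Fin n → ℕ) → 0 < sumFin f → ∃[ i ] 0 < f i
sumFin-witness {suc n} f 0<Σf with f zero in f₀≡
... | suc _ = zero , subst (0 <_) (sym f₀≡) z<s
... | zero  = let i , 0<fi = sumFin-witness (f ∘ suc) 0<Σf in suc i , 0<fi

indicator : Bool → ℕ
indicator b = if b then 1 else 0

indicator-positive : ∀ {b} → 0 < indicator b → b ≡ true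
indicator-positive {true} _ = refl

indicator-∪ : ∀ {a b c} → (a ≡ true → b ≡ true ⊎ c ≡ true) → indicator a ≤ indicator b + indicator c
indicator-∪ {false} _ = z≤n
indicator-∪ {true} a⇒b∨c with a⇒b∨c refl
... | inj₁ refl = s≤s z≤n
... | inj₂ refl = m≤n+m 1 _

count≡sumFin : ∀ {n} (p : Fin n → Bool) → count p ≡ sumFin (indicator ∘ p)
count≡sumFin {zero}  p = refl
count≡sumFin {suc n} p = cong (indicator (p zero) +_) (count≡sumFin (p ∘ suc))

count+count : ∀ {n} (p q : Fin n → Bool) →
  count p + count q ≡ sumFin (λ i → indicator (p i) + indicator (q i))
count+count p q =
  trans (cong₂ _+_ (count≡sumFin p) (count≡sumFin q)) (sym (sumFin-distrib-+ (indicator ∘ p) (indicator ∘ q)))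

count-+ : ∀ {n} {p q r : Fin n → Bool} → (∀ i → indicator (p i) ≡ indicator (q i) + indicator (r i)) →
  count p ≡ count q + count r
count-+ {p = p} {q} {r} split = trans (count≡sumFin p) (trans (sumFin-cong split) (sym (count+count q r)))

count-∪ : ∀ {n} {p q r : Fin n → Bool} → (∀ i → p i ≡ true → q i ≡ true ⊎ r i ≡ true) →
  count p ≤ count q + count r
count-∪ {p = p} {q} {r} cover = begin
  count p                                           ≡⟨ count≡sumFin p ⟩
  sumFin (indicator ∘ p)                            ≤⟨ sumFin-mono (λ i → indicator-∪ (cover i)) ⟩
  sumFin (λ i → indicator (q i) + indicator (r i))  ≡⟨ count+count q r ⟨
  count q + count r                                 ∎
  where open ≤-Reasoning

count-false : ∀ {n} → count {n} (λ _ → false) ≡ 0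
count-false {zero}  = refl
count-false {suc n} = count-false {n}

count-witness : ∀ {n} (p : Fin n → Bool) → 0 < count p → ∃[ i ] p i ≡ true
count-witness p 0<count =
  map₂ indicator-positive (sumFin-witness (indicator ∘ p) (subst (0 <_) (count≡sumFin p) 0<count))

-- The test comes first so that (p ∖ a) i computes when i and a start with different constructors.
infixl 5 _∖_
_∖_ : ∀ {n} → (Fin n → Bool) → Fin n → Fin n → Bool
(p ∖ a) i = not (does (i ≟ a)) ∧ p i

∖-intro : ∀ {n} {p : Fin n → Bool} {a i} → i ≢ a → p i ≡ true → (p ∖ a) i ≡ true
∖-intro {a = a} {i} i≢a pi rewrite dec-false (i ≟ a) i≢a = pi

∖-elim : ∀ {n} {p : Fin n → Bool} {a i} → (p ∖ a) i ≡ true → i ≢ a × p i ≡ true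
∖-elim {a = a} {i} i∈p∖a with i ≟ a
... | no i≢a = i≢a , i∈p∖a

count-remove : ∀ {n} (p : Fin n → Bool) {a} → p a ≡ true → count p ≡ suc (count (p ∖ a))
count-remove p {zero}  pa rewrite pa = refl
count-remove p {suc a} pa =
  trans (cong (indicator (p zero) +_) (count-remove (p ∘ suc) pa)) (+-suc _ _)

count-remove₂ : ∀ {n} (p : Fin n → Bool) {a b} → a ≢ b → p a ≡ true → p b ≡ true →
  count p ≡ 2 + count (p ∖ a ∖ b)
count-remove₂ p {a} a≢b pa pb = trans (count-remove p pa) (cong suc (count-remove (p ∖ a) (∖-intro {p = p} (a≢b ∘ sym) pb)))

ordered : ∀ {n} → (Fin n → Fin n → Bool) → Fin n → Fin n → Bool
ordered R y z = (toℕ y <ᵇ toℕ z) ∧ R y z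

countPairs : ∀ {n} → (Fin n → Fin n → Bool) → ℕ
countPairs R = sumFin (λ y → count (ordered R y))

ordered-intro : ∀ {n} {R : Fin n → Fin n → Bool} {y z} → toℕ y < toℕ z → R y z ≡ true → ordered R y z ≡ true
ordered-intro y<z Ryz = cong₂ _∧_ (Equivalence.to T-≡ (<⇒<ᵇ y<z)) Ryz

ordered-elim : ∀ {n} {R : Fin n → Fin n → Bool} {y z} → ordered R y z ≡ true → toℕ y < toℕ z × R y z ≡ true
ordered-elim {y = y} {z} yz = let y<ᵇz , Ryz = ∧-true⁻ yz in <ᵇ⇒< (toℕ y) (toℕ z) (Equivalence.from T-≡ y<ᵇz) , Ryz

orient : ∀ {n} {R : Fin n → Fin n → Bool} → (∀ y z → R y z ≡ R z y) → ∀ {a b} → a ≢ b → R a b ≡ true →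
  ∃₂ λ y z → ordered R y z ≡ true × ((y , z) ≡ (a , b) ⊎ (y , z) ≡ (b , a))
orient {R = R} R-sym {a} {b} a≢b Rab with <-cmp (toℕ a) (toℕ b)
... | tri< a<b _ _ = a , b , ordered-intro {R = R} a<b Rab , inj₁ refl
... | tri≈ _ a≡b _ = ⊥-elim (a≢b (toℕ-injective a≡b))
... | tri> _ _ b<a = b , a , ordered-intro {R = R} b<a (trans (R-sym b a) Rab) , inj₂ refl

nC2+n≡[n+1]C2 : ∀ n → n + n C 2 ≡ suc n C 2
nC2+n≡[n+1]C2 n = trans (cong (_+ n C 2) (sym (nC1≡n n))) (nCk+nC[k+1]≡[n+1]C[k+1] n 1)

countPairs-complete : ∀ {n} (p : Fin n → Bool) → countPairs (λ y z → p y ∧ p z) ≡ count p C 2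
countPairs-complete {zero}  p = refl
countPairs-complete {suc n} p with p zero
... | true  = trans (cong (count (p ∘ suc) +_) (countPairs-complete (p ∘ suc))) (nC2+n≡[n+1]C2 (count (p ∘ suc)))
... | false = cong₂ _+_ (count-false {n}) (countPairs-complete (p ∘ suc))

indicator-split : ∀ l a b c → indicator (l ∧ a ∧ b) ≡ indicator (l ∧ a ∧ b ∧ c) + indicator (l ∧ a ∧ b ∧ not c)
indicator-split false _     _     _     = refl
indicator-split true  false _     _     = refl
indicator-split true  true  false _     = refl
indicator-split true  true  true  false = refl
indicator-split true  true  true  true  = refl

countPairs-split : ∀ {n} (p : Fin n → Bool) (q : Fin n → Fin n → Bool) →
  countPairs (λ y z → p y ∧ p z) ≡
  countPairs (λ y z → p y ∧ p z ∧ q y z) + countPairs (λ y z → p y ∧ p z ∧ not (q y z))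
countPairs-split {n} p q =
  trans (sumFin-cong (λ y → count-+ {q = ordered with-q y} {r = ordered without-q y}
                              (λ z → indicator-split (toℕ y <ᵇ toℕ z) (p y) (p z) (q y z))))
        (sumFin-distrib-+ (count ∘ ordered with-q) (count ∘ ordered without-q))
  where
  with-q without-q : Fin n → Fin n → Bool
  with-q    y z = p y ∧ p z ∧ q y z
  without-q y z = p y ∧ p z ∧ not (q y z)

countPairs-two : ∀ {n} (R : Fin n → Fin n → Bool) {y₁ z₁ y₂ z₂} → (y₁ , z₁) ≢ (y₂ , z₂) →
  ordered R y₁ z₁ ≡ true → ordered R y₂ z₂ ≡ true → 2 ≤ countPairs R
countPairs-two R {y₁} {z₁} {y₂} {z₂} p₁≢p₂ r₁ r₂ = begin
  2                                                         ≡⟨ cong₂ _+_ (cong indicator r₁) (cong indicator r₂) ⟨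
  indicator (ordered R y₁ z₁) + indicator (ordered R y₂ z₂)  ≤⟨ sumFin²-two-points (λ y z → indicator (ordered R y z)) p₁≢p₂ ⟩
  sumFin (λ y → sumFin (indicator ∘ ordered R y))            ≡⟨ sumFin-cong (λ y → count≡sumFin (ordered R y)) ⟨
  countPairs R                                              ∎
  where open ≤-Reasoning

countPairs-two-unordered : ∀ {n} {R : Fin n → Fin n → Bool} → (∀ y z → R y z ≡ R z y) →
  ∀ {a b c d} → a ≢ b → R a b ≡ true → c ≢ d → R c d ≡ true → c ≢ a → c ≢ b → 2 ≤ countPairs R
countPairs-two-unordered {R = R} R-sym {a} {b} {c} {d} a≢b Rab c≢d Rcd c≢a c≢b =
  let y₁ , z₁ , r₁ , p₁ = orient R-sym a≢b Rab
      y₂ , z₂ , r₂ , p₂ = orient R-sym c≢d Rcd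
  in countPairs-two R (distinct p₁ p₂) r₁ r₂
  where
  distinct : ∀ {p q} → p ≡ (a , b) ⊎ p ≡ (b , a) → q ≡ (c , d) ⊎ q ≡ (d , c) → p ≢ q
  distinct (inj₁ refl) (inj₁ refl) p≡q = c≢a (sym (cong proj₁ p≡q))
  distinct (inj₁ refl) (inj₂ refl) p≡q = c≢b (sym (cong proj₂ p≡q))
  distinct (inj₂ refl) (inj₁ refl) p≡q = c≢b (sym (cong proj₁ p≡q))
  distinct (inj₂ refl) (inj₂ refl) p≡q = c≢a (sym (cong proj₂ p≡q))

countPairs-witness : ∀ {n} (R : Fin n → Fin n → Bool) → 0 < countPairs R → ∃₂ λ y z → y ≢ z × R y z ≡ true
countPairs-witness R 0<pairs =
  let y , 0<count = sumFin-witness (λ y → count (ordered R y)) 0<pairs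
      z , yz      = count-witness (ordered R y) 0<count
      y<z , Ryz   = ordered-elim {R = R} yz
  in y , z , (λ y≡z → <-irrefl (cong toℕ y≡z) y<z) , Ryz

0<nC2 : ∀ {n} → 2 ≤ n → 0 < n C 2
0<nC2 {suc (suc m)} (s≤s (s≤s _)) = subst (0 <_) (nC2+n≡[n+1]C2 (suc m)) z<s

module _ {v} (G : Graph v) where

  adj-sym : ∀ {x y} → adj G x y ≡ true → adj G y x ≡ true
  adj-sym {x} {y} x∼y = trans (Graph.sym G y x) x∼y

  adj-≢ : ∀ {x a b} → adj G x a ≡ true → adj G x b ≡ false → a ≢ b
  adj-≢ x∼a x≁b refl with trans (sym x∼a) x≁b
  ... | ()

  adj⇒≢ : ∀ {x y} → adj G x y ≡ true → x ≢ y
  adj⇒≢ {x} x∼y x≡y = adj-≢ x∼y (Graph.irrefl G x) (sym x≡y)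

  nonEdgeAtᵇ : Fin v → Fin v → Fin v → Bool
  nonEdgeAtᵇ x y z = adj G x y ∧ adj G x z ∧ not (adj G y z)

  nonEdgeAtᵇ-sym : ∀ x y z → nonEdgeAtᵇ x y z ≡ nonEdgeAtᵇ x z y
  nonEdgeAtᵇ-sym x y z =
    trans (∧-leftComm (adj G x y) (adj G x z) _) (cong (λ b → adj G x z ∧ adj G x y ∧ not b) (Graph.sym G y z))

  nonEdgesAt : Fin v → ℕ
  nonEdgesAt x = countPairs (nonEdgeAtᵇ x)

  trianglesAt+nonEdgesAt : ∀ x → trianglesAt G x + nonEdgesAt x ≡ degree G x C 2
  trianglesAt+nonEdgesAt x = trans (sym (countPairs-split (adj G x) (adj G))) (countPairs-complete (adj G x))

  nonEdgesAt≡1 : ∀ {k} → 2 ≤ k → Regular G k → (∀ x → trianglesAt G x ≡ k C 2 ∸ 1) → ∀ x → nonEdgesAt x ≡ 1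
  nonEdgesAt≡1 {k} 2≤k regular triangles x = +-cancelˡ-≡ (k C 2 ∸ 1) (nonEdgesAt x) 1 (begin
    k C 2 ∸ 1 + nonEdgesAt x       ≡⟨ cong (_+ nonEdgesAt x) (triangles x) ⟨
    trianglesAt G x + nonEdgesAt x ≡⟨ trianglesAt+nonEdgesAt x ⟩
    degree G x C 2                 ≡⟨ cong (_C 2) (regular x) ⟩
    k C 2                          ≡⟨ m∸n+n≡m (0<nC2 2≤k) ⟨
    k C 2 ∸ 1 + 1                  ∎)
    where open ≡-Reasoning

  record NonEdgeAt (x y z : Fin v) : Set where
    constructor nonEdge
    field
      y≢z : y ≢ z
      x∼y : adj G x y ≡ true
      x∼z : adj G x z ≡ true
      y≁z : adj G y z ≡ false

  NonEdgeAt-swap : ∀ {x y z} → NonEdgeAt x y z → NonEdgeAt x z y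
  NonEdgeAt-swap (nonEdge y≢z x∼y x∼z y≁z) = nonEdge (y≢z ∘ sym) x∼z x∼y (trans (Graph.sym G _ _) y≁z)

  NonEdgeAt⇒ᵇ : ∀ {x y z} → NonEdgeAt x y z → nonEdgeAtᵇ x y z ≡ true
  NonEdgeAt⇒ᵇ (nonEdge _ x∼y x∼z y≁z) rewrite x∼y | x∼z | y≁z = refl

  ᵇ⇒NonEdgeAt : ∀ {x y z} → y ≢ z → nonEdgeAtᵇ x y z ≡ true → NonEdgeAt x y z
  ᵇ⇒NonEdgeAt y≢z xyz =
    let x∼y , xz∧y≁z = ∧-true⁻ xyz
        x∼z , y≁z    = ∧-true⁻ xz∧y≁z
    in nonEdge y≢z x∼y x∼z (not-true⁻ y≁z)

  nonEdgeAt-exists : ∀ {x} → 0 < nonEdgesAt x → ∃₂ (NonEdgeAt x)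
  nonEdgeAt-exists {x} 0<nonEdges =
    let y , z , y≢z , xyz = countPairs-witness (nonEdgeAtᵇ x) 0<nonEdges
    in y , z , ᵇ⇒NonEdgeAt y≢z xyz

  nonEdgeAt-unique : ∀ {x a b c d} → nonEdgesAt x ≤ 1 → NonEdgeAt x a b → NonEdgeAt x c d → c ≢ a → c ≢ b → ⊥
  nonEdgeAt-unique {x} ≤1 ab cd c≢a c≢b =
    ≤⇒≯ ≤1 (countPairs-two-unordered (nonEdgeAtᵇ-sym x) (NonEdgeAt.y≢z ab) (NonEdgeAt⇒ᵇ ab)
                                      (NonEdgeAt.y≢z cd) (NonEdgeAt⇒ᵇ cd) c≢a c≢b)

  adjacent-to-nonEdge : ∀ {x y z w} → nonEdgesAt x ≤ 1 → NonEdgeAt x y z →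
    adj G x w ≡ true → w ≢ y → w ≢ z → adj G w y ≡ true
  adjacent-to-nonEdge {y = y} {w = w} ≤1 yz x∼w w≢y w≢z with adj G w y in w-y
  ... | true  = refl
  ... | false = ⊥-elim (nonEdgeAt-unique ≤1 yz (nonEdge w≢y x∼w (NonEdgeAt.x∼y yz) w-y) w≢y w≢z)

  degree≡2+others : ∀ {x y z} → NonEdgeAt x y z → degree G x ≡ 2 + count (adj G x ∖ y ∖ z)
  degree≡2+others {x} (nonEdge y≢z x∼y x∼z _) = count-remove₂ (adj G x) y≢z x∼y x∼z

  module _ {k} (regular : Regular G k) where

    third-neighbour : ∀ {x y z} → 3 ≤ k → NonEdgeAt x y z → ∃[ w ] adj G x w ≡ true × w ≢ y × w ≢ z
    third-neighbour {x} {y} 3≤k yz =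
      let 3≤2+others  = subst (3 ≤_) (trans (sym (regular x)) (degree≡2+others yz)) 3≤k
          w , w∈      = count-witness _ (s≤s⁻¹ (s≤s⁻¹ 3≤2+others))
          w≢z , w∈′   = ∖-elim {p = adj G x ∖ y} w∈
          w≢y , x∼w   = ∖-elim {p = adj G x} w∈′
      in w , x∼w , w≢y , w≢z

    outside-neighbour : ∀ {x y z} → NonEdgeAt x y z → ∃[ u ] adj G y u ≡ true × u ≢ x × adj G x u ≡ false
    outside-neighbour {x} {y} {z} yz@(nonEdge _ x∼y _ y≁z) =
      let u , u∈     = count-witness outside (+-cancelʳ-< (count others) 0 (count outside) bound)
          x≁u , u∈′  = ∧-true⁻ u∈
          u≢x , y∼u  = ∖-elim {p = adj G y} u∈′
      in u , y∼u , u≢x , not-true⁻ x≁u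
      where
      others outside : Fin v → Bool
      others  = adj G x ∖ y ∖ z
      outside t = not (adj G x t) ∧ (adj G y ∖ x) t

      cover : ∀ t → (adj G y ∖ x) t ≡ true → outside t ≡ true ⊎ others t ≡ true
      cover t t∈ with adj G x t ≟ᵇ true
      ... | no x≁t  = inj₁ (cong₂ _∧_ (cong not (¬-not x≁t)) t∈)
      ... | yes x∼t = let _ , y∼t = ∖-elim {p = adj G y} t∈ in
        inj₂ (∖-intro {p = adj G x ∖ y} (adj-≢ y∼t y≁z) (∖-intro {p = adj G x} (adj⇒≢ y∼t ∘ sym) x∼t))

      bound : suc (count others) ≤ count outside + count others
      bound = begin
        suc (count others)            ≡⟨ suc-injective (begin-equality
          2 + count others              ≡⟨ degree≡2+others yz ⟨
          degree G x                    ≡⟨ regular x ⟩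
          k                             ≡⟨ regular y ⟨
          degree G y                    ≡⟨ count-remove (adj G y) (adj-sym x∼y) ⟩
          suc (count (adj G y ∖ x))     ∎) ⟩
        count (adj G y ∖ x)           ≤⟨ count-∪ cover ⟩
        count outside + count others  ∎
        where open ≤-Reasoning

    module _ (≤1 : ∀ x → nonEdgesAt x ≤ 1) where

      two-nonEdges : ∀ {x y z w u} → NonEdgeAt x y z →
        adj G x w ≡ true → adj G w y ≡ true → adj G w z ≡ true →
        adj G y u ≡ true → u ≢ x → adj G x u ≡ false → ⊥
      two-nonEdges {y = y} {w = w} {u} (nonEdge y≢z x∼y x∼z y≁z) x∼w w∼y w∼z y∼u u≢x x≁u with adj G w u in w-u
      ... | true  = nonEdgeAt-unique (≤1 w)
                      (nonEdge y≢z w∼y w∼z y≁z)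
                      (nonEdge (u≢x ∘ sym) (adj-sym x∼w) w-u x≁u)
                      (adj⇒≢ x∼y) (adj⇒≢ x∼z)
      ... | false = nonEdgeAt-unique (≤1 y)
                      (nonEdge (u≢x ∘ sym) (adj-sym x∼y) y∼u x≁u)
                      (nonEdge w≢u (adj-sym w∼y) y∼u w-u)
                      (adj⇒≢ x∼w ∘ sym) w≢u
        where
        w≢u : w ≢ u
        w≢u = adj-≢ x∼w x≁u

      no-nonEdgeAt : 3 ≤ k → ∀ {x y z} → ¬ NonEdgeAt x y z
      no-nonEdgeAt 3≤k {x} yz =
        let w , x∼w , w≢y , w≢z = third-neighbour 3≤k yz
            u , y∼u , u≢x , x≁u = outside-neighbour yz
            w∼y = adjacent-to-nonEdge (≤1 x) yz x∼w w≢y w≢z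
            w∼z = adjacent-to-nonEdge (≤1 x) (NonEdgeAt-swap yz) x∼w w≢z w≢y
        in two-nonEdges yz x∼w w∼y w∼z y∼u u≢x x≁u

lemma1 : (k : ℕ) → 3 ≤ k → (v : ℕ) → (G : Graph v) →
    Regular G k → Girth3 G → (∀ x → trianglesAt G x ≡ (k C 2) ∸ 1) → ⊥
-- Girth 3 is only used to provide a vertex.
lemma1 k 3≤k v G regular (x , _) triangles =
  let y , z , yz = nonEdgeAt-exists G (subst (0 <_) (sym (one-nonEdge x)) z<s)
  in no-nonEdgeAt G regular (≤-reflexive ∘ one-nonEdge) 3≤k yz
  where
  one-nonEdge : ∀ x → nonEdgesAt G x ≡ 1
  one-nonEdge = nonEdgesAt≡1 G (≤-trans (n≤1+n 2) 3≤k) regular triangles
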